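{- Let $D$ be a directed multigraph and let $X\subseteq V(D)$ be such that every vertex of $D-X$ has at least two (distinct) in-neighbours and at least two (distinct) out-neighbours in $X$. If the directed multigraph $D\langle X\rangle$ induced by $X$ has a strong arc decomposition, then $D$ has a strong arc decomposition.
   Context: A directed multigraph may have parallel arcs but no loops. $D-X$ denotes the subdigraph induced by $V(D)\setminus X$. A directed multigraph is strong if there is a directed path from $x$ to $y$ for every ordered pair of distinct vertices $x,y$. A strong arc decomposition of $D=(V,A)$ is a partition of $A$ into two disjoint sets $A_1,A_2$ such that both spanning subdigraphs $(V,A_1)$ and $(V,A_2)$ are strong. -}

module Defs where

open import Data.Nat using (ℕ)
open import Data.Fin using (Fin)
open import Data.Fin.Subset using (Subset; _∈_; _∉_)
open import Data.Bool using (Bool; true; false)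
open import Data.Product using (Σ; _×_; _,_; ∃-syntax)
open import Relation.Binary.PropositionalEquality using (_≡_; _≢_)

-- A finite directed multigraph: vertices Fin n, arcs Fin m (parallel arcs
-- allowed since distinct arc indices may have equal endpoints), no loops.
record Digraph : Set where
  field
    n    : ℕ
    m    : ℕ
    tail : Fin m → Fin n
    head : Fin m → Fin n
    loopless : (a : Fin m) → tail a ≢ head a

open Digraph public

ArcSet : Digraph → Set₁
ArcSet D = Fin (m D) → Set

-- Reach D S x y : there is a directed walk from x to y using only arcs in S
-- (equivalently a directed path, by shortcutting).
data Reach (D : Digraph) (S : ArcSet D) : Fin (n D) → Fin (n D) → Set where
  here : ∀ {x} → Reach D S x x
  step : ∀ {y} (a : Fin (m D)) → S a → Reach D S (head D a) y → Reach D S (tail D a) y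

-- The spanning subdigraph with vertex set W and arc set S is strong:
-- every ordered pair of distinct vertices of W is joined by a directed path
-- using arcs from S.  (S will only contain arcs with both ends in W.)
StrongOn : (D : Digraph) → Subset (n D) → ArcSet D → Set
StrongOn D W S = ∀ x y → x ∈ W → y ∈ W → x ≢ y → Reach D S x y

InducedArc : (D : Digraph) → Subset (n D) → ArcSet D
InducedArc D X a = (tail D a ∈ X) × (head D a ∈ X)

ColourClass : (D : Digraph) → Subset (n D) → (Fin (m D) → Bool) → Bool → ArcSet D
ColourClass D X c i a = InducedArc D X a × (c a ≡ i)

-- D⟨X⟩ has a strong arc decomposition: a partition (given by a 2-colouring)
-- of the arcs of D⟨X⟩ into A₁, A₂ with (X,A₁) and (X,A₂) both strong.
HasStrongArcDecompOn : (D : Digraph) → Subset (n D) → Set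
HasStrongArcDecompOn D X =
  ∃[ c ] (StrongOn D X (ColourClass D X c true) × StrongOn D X (ColourClass D X c false))

Full : (D : Digraph) → Subset (n D)
Full D = Data.Fin.Subset.⊤

HasStrongArcDecomp : Digraph → Set
HasStrongArcDecomp D = HasStrongArcDecompOn D (Full D)

TwoInNbrsIn : (D : Digraph) → Subset (n D) → Fin (n D) → Set
TwoInNbrsIn D X v =
  ∃[ u₁ ] ∃[ u₂ ] ∃[ a₁ ] ∃[ a₂ ]
    (u₁ ∈ X × u₂ ∈ X × u₁ ≢ u₂ ×
     tail D a₁ ≡ u₁ × head D a₁ ≡ v × tail D a₂ ≡ u₂ × head D a₂ ≡ v)

TwoOutNbrsIn : (D : Digraph) → Subset (n D) → Fin (n D) → Set
TwoOutNbrsIn D X v =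
  ∃[ w₁ ] ∃[ w₂ ] ∃[ a₁ ] ∃[ a₂ ]
    (w₁ ∈ X × w₂ ∈ X × w₁ ≢ w₂ ×
     tail D a₁ ≡ v × head D a₁ ≡ w₁ × tail D a₂ ≡ v × head D a₂ ≡ w₂)

-- Keep the arcs of D⟨X⟩ coloured as in the given decomposition.  A vertex
-- v ∉ X has in-arcs a₁, a₂ from distinct vertices of X; give a₂ colour true
-- and every other arc entering v colour false, and treat arcs from v into X
-- dually.  Then in each colour every vertex has an arc into X and an arc
-- from X, so every ordered pair is joined through the strong core X.
module Submission where

open import Defs
open import Data.Bool using (Bool; true; false)
open import Data.Empty using (⊥-elim)
open import Data.Fin using (Fin; _≟_)
open import Data.Fin.Subset using (Subset; _∈_; _∉_)
open import Data.Fin.Subset.Properties using (_∈?_; ∈⊤)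
open import Data.Product using (_×_; _,_; proj₁; proj₂; ∃-syntax)
open import Relation.Nullary using (Dec; yes; no; does)
open import Relation.Nullary.Decidable using (dec-true; dec-false)
open import Relation.Binary.PropositionalEquality using (_≡_; refl; sym; trans; cong; subst)

module _ {D : Digraph} where

  reach-trans : ∀ {S x y z} → Reach D S x y → Reach D S y z → Reach D S x z
  reach-trans here         q = q
  reach-trans (step a s p) q = step a s (reach-trans p q)

  reach-mono : ∀ {S T : ArcSet D} → (∀ {a} → S a → T a) →
               ∀ {x y} → Reach D S x y → Reach D T x y
  reach-mono S⊆T here         = here
  reach-mono S⊆T (step a s p) = step a (S⊆T s) (reach-mono S⊆T p)

  reach-arc : ∀ {S x y} a → S a → tail D a ≡ x → head D a ≡ y → Reach D S x y
  reach-arc a s refl refl = step a s here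

  strongOn-mono : ∀ {W} {S T : ArcSet D} → (∀ {a} → S a → T a) →
                  StrongOn D W S → StrongOn D W T
  strongOn-mono S⊆T strong x y x∈W y∈W x≢y = reach-mono S⊆T (strong x y x∈W y∈W x≢y)

  strongOn⇒reach : ∀ {W S x y} → StrongOn D W S → x ∈ W → y ∈ W → Reach D S x y
  strongOn⇒reach {x = x} {y} strong x∈W y∈W with x ≟ y
  ... | yes refl = here
  ... | no  x≢y  = strong x y x∈W y∈W x≢y

  strongOn-⊤ : ∀ {W S} → StrongOn D W S →
               (∀ x → ∃[ w ] (w ∈ W × Reach D S x w)) →
               (∀ y → ∃[ u ] (u ∈ W × Reach D S u y)) →
               StrongOn D (Full D) S
  strongOn-⊤ strong toW fromW x y _ _ _ with toW x | fromW y
  ... | w , w∈W , x↝w | u , u∈W , u↝y =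
    reach-trans x↝w (reach-trans (strongOn⇒reach strong w∈W u∈W) u↝y)

module Pivots (D : Digraph) (X : Subset (n D)) {v : Fin (n D)} where

  pivotIn : TwoInNbrsIn D X v → Fin (m D)
  pivotIn (_ , _ , _ , a₂ , _) = a₂

  pivotOut : TwoOutNbrsIn D X v → Fin (m D)
  pivotOut (_ , _ , _ , b₂ , _) = b₂

  inArc-withMark : (t : TwoInNbrsIn D X v) (i : Bool) →
                   ∃[ a ] (tail D a ∈ X × head D a ≡ v × does (a ≟ pivotIn t) ≡ i)
  inArc-withMark (u₁ , u₂ , a₁ , a₂ , u₁∈X , u₂∈X , u₁≢u₂ , t₁ , h₁ , t₂ , h₂) true =
    a₂ , subst (_∈ X) (sym t₂) u₂∈X , h₂ , dec-true (a₂ ≟ a₂) refl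
  inArc-withMark (u₁ , u₂ , a₁ , a₂ , u₁∈X , u₂∈X , u₁≢u₂ , t₁ , h₁ , t₂ , h₂) false =
    a₁ , subst (_∈ X) (sym t₁) u₁∈X , h₁ ,
    dec-false (a₁ ≟ a₂) λ { refl → u₁≢u₂ (trans (sym t₁) t₂) }

  outArc-withMark : (t : TwoOutNbrsIn D X v) (i : Bool) →
                    ∃[ b ] (tail D b ≡ v × head D b ∈ X × does (b ≟ pivotOut t) ≡ i)
  outArc-withMark (w₁ , w₂ , b₁ , b₂ , w₁∈X , w₂∈X , w₁≢w₂ , t₁ , h₁ , t₂ , h₂) true =
    b₂ , t₂ , subst (_∈ X) (sym h₂) w₂∈X , dec-true (b₂ ≟ b₂) refl
  outArc-withMark (w₁ , w₂ , b₁ , b₂ , w₁∈X , w₂∈X , w₁≢w₂ , t₁ , h₁ , t₂ , h₂) false =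
    b₁ , t₁ , subst (_∈ X) (sym h₁) w₁∈X ,
    dec-false (b₁ ≟ b₂) λ { refl → w₁≢w₂ (trans (sym h₁) h₂) }

module Extension (D : Digraph) (X : Subset (n D))
  (nbrs : ∀ v → v ∉ X → TwoInNbrsIn D X v × TwoOutNbrsIn D X v)
  (c : Fin (m D) → Bool) where

  open Pivots D X

  -- Proofs of v ∉ X need not be equal, so the witness nbrs v is selected
  -- through the single decision v ∈? X; thus all arcs at v consult the same
  -- pivot arc.
  exitColour : (w : Fin (n D)) → Dec (w ∈ X) → Fin (m D) → Bool
  exitColour w (no w∉X) b = does (b ≟ pivotOut (proj₂ (nbrs w w∉X)))
  exitColour w (yes _)  b = c b

  enterColour : (v : Fin (n D)) → Dec (v ∈ X) → Fin (m D) → Bool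
  enterColour v (no v∉X) a = does (a ≟ pivotIn (proj₁ (nbrs v v∉X)))
  enterColour v (yes _)  a = exitColour (tail D a) (tail D a ∈? X) a

  colour : Fin (m D) → Bool
  colour a = enterColour (head D a) (head D a ∈? X) a

  Class : Bool → ArcSet D
  Class = ColourClass D (Full D) colour

  enterColour-inArc : ∀ v (d : Dec (v ∈ X)) → v ∉ X → ∀ i →
                      ∃[ a ] (tail D a ∈ X × head D a ≡ v × enterColour v d a ≡ i)
  enterColour-inArc v (yes v∈X) v∉X i = ⊥-elim (v∉X v∈X)
  enterColour-inArc v (no v∉X)  _   i = inArc-withMark (proj₁ (nbrs v v∉X)) i

  exitColour-outArc : ∀ w (d : Dec (w ∈ X)) → w ∉ X → ∀ i →
                      ∃[ b ] (tail D b ≡ w × head D b ∈ X × exitColour w d b ≡ i)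
  exitColour-outArc w (yes w∈X) w∉X i = ⊥-elim (w∉X w∈X)
  exitColour-outArc w (no w∉X)  _   i = outArc-withMark (proj₂ (nbrs w w∉X)) i

  enterColour-∈ : ∀ {v} (d : Dec (v ∈ X)) → v ∈ X → ∀ a →
                  enterColour v d a ≡ exitColour (tail D a) (tail D a ∈? X) a
  enterColour-∈ (yes _)   _   a = refl
  enterColour-∈ (no v∉X) v∈X a = ⊥-elim (v∉X v∈X)

  exitColour-∈ : ∀ {w} (d : Dec (w ∈ X)) → w ∈ X → ∀ b → exitColour w d b ≡ c b
  exitColour-∈ (yes _)   _   b = refl
  exitColour-∈ (no w∉X) w∈X b = ⊥-elim (w∉X w∈X)

  colour-induced : ∀ {a} → InducedArc D X a → colour a ≡ c a
  colour-induced {a} (t∈X , h∈X) =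
    trans (enterColour-∈ (head D a ∈? X) h∈X a) (exitColour-∈ (tail D a ∈? X) t∈X a)

  reachedFromX : ∀ i y → ∃[ u ] (u ∈ X × Reach D (Class i) u y)
  reachedFromX i y with y ∈? X
  ... | yes y∈X = y , y∈X , here
  ... | no  y∉X with enterColour-inArc y (y ∈? X) y∉X i
  ...   | a , t∈X , h≡y , mark≡i = tail D a , t∈X , reach-arc a ((∈⊤ , ∈⊤) , a∈i) refl h≡y
    where
    a∈i : colour a ≡ i
    a∈i = trans (cong (λ v → enterColour v (v ∈? X) a) h≡y) mark≡i

  reachesX : ∀ i x → ∃[ w ] (w ∈ X × Reach D (Class i) x w)
  reachesX i x with x ∈? X
  ... | yes x∈X = x , x∈X , here
  ... | no  x∉X with exitColour-outArc x (x ∈? X) x∉X i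
  ...   | b , t≡x , h∈X , mark≡i = head D b , h∈X , reach-arc b ((∈⊤ , ∈⊤) , b∈i) t≡x refl
    where
    b∈i : colour b ≡ i
    b∈i = trans (enterColour-∈ (head D b ∈? X) h∈X b)
                (trans (cong (λ w → exitColour w (w ∈? X) b) t≡x) mark≡i)

  induced⊆Class : ∀ {i a} → ColourClass D X c i a → Class i a
  induced⊆Class (induced , c≡i) = (∈⊤ , ∈⊤) , trans (colour-induced induced) c≡i

  colour-strong : ∀ i → StrongOn D X (ColourClass D X c i) → StrongOn D (Full D) (Class i)
  colour-strong i strong =
    strongOn-⊤ (strongOn-mono induced⊆Class strong) (reachesX i) (reachedFromX i)

lemma2p4 : (D : Digraph) (X : Subset (n D)) →
    (∀ v → v ∉ X → TwoInNbrsIn D X v × TwoOutNbrsIn D X v) →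
    HasStrongArcDecompOn D X →
    HasStrongArcDecomp D
lemma2p4 D X nbrs (c , strong₁ , strong₂) =
  colour , colour-strong true strong₁ , colour-strong false strong₂
  where open Extension D X nbrs c
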